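{- Let $X \in \{\mathit{eq},\mathit{disj},\mathit{closed}\}$ and let $F \subseteq \{\mathit{eq},\mathit{disj},\mathit{closed}\}$ be a feature set with $X \notin F$. Then the class of graphs $Q_X$ is not definable in $\mathcal{L}(F)$, i.e., there is no shape schema $\mathcal{S}\in\mathcal{L}(F)$ such that the graphs conforming to $\mathcal{S}$ are exactly the graphs in $Q_X$.
   Context: Fix two disjoint infinite sets $N$ (node names, also called constants) and $P$ (property names). Path expressions are given by $E ::= \mathit{id} \mid p \mid p^- \mid E\cup E \mid E\circ E \mid E^*$ with $p\in P$. Shapes are given by $\phi ::= \top \mid \{c\} \mid \phi\land\phi \mid \phi\lor\phi \mid \neg\phi \mid {\geq_n E}.\phi \mid \mathit{eq}(E,p) \mid \mathit{disj}(E,p) \mid \mathit{closed}(R)$, where $c\in N$, $n\geq 1$ is an integer, $p\in P$, and $R$ is a finite subset of $P$. A graph $G$ is a finite set of triples $(a,p,b)$ with $a,b\in N$, $p\in P$. Semantics on $G$ (domain $N$): $[\![p]\!]^G=\{(a,b):(a,p,b)\in G\}$, $[\![\mathit{id}]\!]^G$ is the identity relation on $N$, $p^-$ is the inverse, $\cup$ is union, $\circ$ is relational composition, $E^*$ is the reflexive-transitive closure on $N$. For a binary relation $R$, $R(x)=\{y:(x,y)\in R\}$. Then $G,a\models\top$ always; $G,a\models\{c\}$ iff $a=c$; boolean connectives as usual; $G,a\models {\geq_n E}.\psi$ iff at least $n$ elements $b\in[\![E]\!]^G(a)$ satisfy $G,b\models\psi$; $G,a\models\mathit{eq}(E,p)$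 iff $[\![E]\!]^G(a)=[\![p]\!]^G(a)$; $G,a\models\mathit{disj}(E,p)$ iff these sets are disjoint; $G,a\models\mathit{closed}(R)$ iff $[\![p]\!]^G(a)=\emptyset$ for every $p\in P\setminus R$. Write $[\![\phi]\!]^G=\{a\in N: G,a\models\phi\}$. A shape schema is a finite set of inclusions $\phi_1\subseteq\phi_2$ of shapes; $G$ conforms to it if $[\![\phi_1]\!]^G\subseteq[\![\phi_2]\!]^G$ for every inclusion. For a feature set $F\subseteq\{\mathit{eq},\mathit{disj},\mathit{closed}\}$, $\mathcal{L}(F)$ is the set of shape schemas in which the constructs $\mathit{eq}(E,p)$, $\mathit{disj}(E,p)$, $\mathit{closed}(R)$ are used only if $\mathit{eq}\in F$, $\mathit{disj}\in F$, $\mathit{closed}\in F$, respectively (all other constructs are always allowed). Fix a property name $r$. $Q_{\mathit{eq}}$ is the class of graphs $G$ such that $(a,r,b)\in G$ implies $(b,r,a)\in G$. $Q_{\mathit{disj}}$ is the class of graphs $G$ such that every node $a$ with some outgoing $r$-edge has some $b$ with $(a,r,b)\in G$ and $(b,r,a)\in G$. $Q_{\mathit{closed}}$ is the class of graphs $G$ such that for every node $a$ with an outgoing $r$-edge, every triple $(a,p,b)\in G$ has $p=r$. -}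

module Defs where

open import Data.Nat using (ℕ; _≤_)
open import Data.Bool using (Bool; true; false)
open import Data.Product using (Σ; ∃; _×_; _,_)
open import Data.Empty using (⊥)
open import Data.Sum using (_⊎_)
open import Data.Unit using (⊤)
open import Data.List using (List; length)
open import Data.List.Membership.Propositional using (_∈_; _∉_)
open import Data.List.Relation.Unary.All using (All)
open import Data.List.Relation.Unary.Unique.Propositional using (Unique)
open import Relation.Binary.PropositionalEquality using (_≡_)
open import Relation.Binary.Construct.Closure.ReflexiveTransitive using (Star)
open import Relation.Nullary using (¬_)
open import Function.Bundles using (_⇔_)

-- Node names (constants) and property names: two infinite sets,
-- disjoint since they are distinct types.
Node : Set
Node = ℕ

Prop : Set
Prop = ℕ

Triple : Set
Triple = Node × Prop × Node

Graph : Set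
Graph = List Triple

data PathExpr : Set where
  idE   : PathExpr
  prop  : Prop → PathExpr
  inv   : Prop → PathExpr
  _∪E_  : PathExpr → PathExpr → PathExpr
  _∘E_  : PathExpr → PathExpr → PathExpr
  star  : PathExpr → PathExpr

data Shape : Set where
  ⊤S      : Shape
  const   : Node → Shape
  _∧S_    : Shape → Shape → Shape
  _∨S_    : Shape → Shape → Shape
  ¬S_     : Shape → Shape
  ≥[_]_∙_ : ℕ → PathExpr → Shape → Shape   -- the count n is used only with n ≥ 1
  eqS     : PathExpr → Prop → Shape
  disjS   : PathExpr → Prop → Shape
  closedS : List Prop → Shape

⟦_⟧E : PathExpr → Graph → Node → Node → Set
⟦ idE ⟧E G a b = a ≡ b
⟦ prop p ⟧E G a b = (a , p , b) ∈ G
⟦ inv p ⟧E G a b = (b , p , a) ∈ G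
⟦ E₁ ∪E E₂ ⟧E G a b = ⟦ E₁ ⟧E G a b ⊎ ⟦ E₂ ⟧E G a b
⟦ E₁ ∘E E₂ ⟧E G a b = ∃ λ c → ⟦ E₁ ⟧E G a c × ⟦ E₂ ⟧E G c b
⟦ star E ⟧E G a b = Star (⟦ E ⟧E G) a b

_,_⊨_ : Graph → Node → Shape → Set
G , a ⊨ ⊤S = ⊤
G , a ⊨ const c = a ≡ c
G , a ⊨ (φ ∧S ψ) = (G , a ⊨ φ) × (G , a ⊨ ψ)
G , a ⊨ (φ ∨S ψ) = (G , a ⊨ φ) ⊎ (G , a ⊨ ψ)
G , a ⊨ (¬S φ) = ¬ (G , a ⊨ φ)
G , a ⊨ (≥[ n ] E ∙ ψ) =
  Σ (List Node) λ bs → length bs ≡ n × Unique bs × All (λ b → ⟦ E ⟧E G a b × (G , b ⊨ ψ)) bs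
G , a ⊨ eqS E p = ∀ b → ⟦ E ⟧E G a b ⇔ ((a , p , b) ∈ G)
G , a ⊨ disjS E p = ∀ b → ⟦ E ⟧E G a b → (a , p , b) ∈ G → ⊥
G , a ⊨ closedS R = ∀ p b → p ∉ R → (a , p , b) ∈ G → ⊥

Schema : Set
Schema = List (Shape × Shape)

Conforms : Graph → Schema → Set
Conforms G S = All (λ { (φ₁ , φ₂) → ∀ a → G , a ⊨ φ₁ → G , a ⊨ φ₂ }) S

data Feature : Set where
  eq disj closed : Feature

FeatureSet : Set
FeatureSet = Feature → Bool

ShapeIn : FeatureSet → Shape → Set
ShapeIn F ⊤S = ⊤
ShapeIn F (const c) = ⊤
ShapeIn F (φ ∧S ψ) = ShapeIn F φ × ShapeIn F ψ
ShapeIn F (φ ∨S ψ) = ShapeIn F φ × ShapeIn F ψ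
ShapeIn F (¬S φ) = ShapeIn F φ
ShapeIn F (≥[ n ] E ∙ ψ) = (1 ≤ n) × ShapeIn F ψ
ShapeIn F (eqS E p) = F eq ≡ true
ShapeIn F (disjS E p) = F disj ≡ true
ShapeIn F (closedS R) = F closed ≡ true

InL : FeatureSet → Schema → Set
InL F S = All (λ { (φ₁ , φ₂) → ShapeIn F φ₁ × ShapeIn F φ₂ }) S

Q : Feature → Prop → Graph → Set
Q eq r G = ∀ a b → (a , r , b) ∈ G → (b , r , a) ∈ G
Q disj r G = ∀ a b → (a , r , b) ∈ G → ∃ λ c → ((a , r , c) ∈ G) × ((c , r , a) ∈ G)
Q closed r G = ∀ a b p c → (a , r , b) ∈ G → (a , p , c) ∈ G → p ≡ r

DefinableIn : FeatureSet → (Graph → Set) → Set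
DefinableIn F C = Σ Schema λ S → InL F S × (∀ G → Conforms G S ⇔ C G)

module Submission where

-- For each X, Q_X is separated from L(F) by a graph in Q_X and a graph outside it such that every
-- schema of L(F) satisfied by the first is satisfied by the second. For closed, the second graph
-- adds an edge whose property the schema never mentions; without closed(R) no shape sees it.
-- For eq and disj, two small block graphs are blown up: each block becomes K nodes, with K ≥ 2
-- above every count and constant of the schema, and each block edge becomes all r-edges between
-- the two blocks. Every path expression then sends a node z to a union of whole blocks, plus z
-- itself if it admits the empty path, as recorded by a Boolean block matrix; so the truth of a
-- shape at z depends only on the block of z, counts only asking whether some block qualifies.
-- For the chosen pairs of block graphs, a finite family of matrix pairs closed under the
-- operations interpreting ∪, ∘ and * shows by evaluation that every shape of L(F) has one and the
-- same value on all blocks of both graphs. Nodes outside the blow-ups are isolated in both graphs.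

open import Defs
open import Data.Bool using (Bool; true; false; T; not; _∧_; _∨_; if_then_else_)
open import Data.Bool.ListAction using (all; any)
open import Data.Bool.Properties using (T-∧; T-∨; T-≡; ⇔→≡) renaming (_≟_ to _≟ᵇ_)
open import Data.Empty using (⊥; ⊥-elim)
open import Data.Unit using (⊤)
open import Data.Fin using (Fin; zero; suc; toℕ; combine; punchIn; inject≤)
open import Data.Fin.Properties
  using (any?; all?; toℕ-injective; combine-injective; punchInᵢ≢i; toℕ-combine; toℕ-inject≤)
open import Data.List using (List; []; _∷_; map; filter; cartesianProduct; allFin; take; length; tabulate)
open import Data.List.Properties using (length-take; length-tabulate)
open import Data.List.Membership.Propositional using (_∈_; _∉_)
open import Data.List.Membership.Propositional.Properties
  using (∈-map⁺; ∈-map⁻; ∈-filter⁺; ∈-filter⁻; ∈-cartesianProduct⁺; ∈-allFin)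
open import Data.List.Relation.Unary.All as All using (All; []; _∷_)
open import Data.List.Relation.Unary.All.Properties using (all⁺; take⁺; tabulate⁺)
open import Data.List.Relation.Unary.AllPairs using ([]; _∷_)
open import Data.List.Relation.Unary.Any as Any using (here; there)
open import Data.List.Relation.Unary.Any.Properties using (any⁻)
open import Data.List.Relation.Unary.Unique.Propositional using (Unique)
import Data.List.Relation.Unary.Unique.Propositional.Properties as Unique
open import Data.Nat
  using (ℕ; zero; suc; _+_; _*_; _∸_; _%_; _⊔_; _≤_; _<_; _≤ᵇ_; s≤s; z≤n; NonZero)
open import Data.Nat.Logarithm using (⌈log₂_⌉)
open import Data.Nat.Properties
  using (_≟_; +-cancelˡ-≡; m≤n⇒m⊓n≡m; ≤ᵇ⇒≤; ≤-antisym; ≤-refl; ≤-trans; <-≤-trans; <⇒≢; <-irrefl;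
         m≤m+n; m≤n+m; m≤m⊔n; m≤n⊔m; m⊔n<o⇒m<o; m⊔n<o⇒n<o)
open import Data.List.Membership.DecPropositional _≟_ using (_∈?_)
open import Data.Product as Product using (∃; _×_; _,_; proj₁; proj₂)
open import Data.Product.Function.NonDependent.Propositional using (_×-⇔_)
open import Data.Sum as Sum using (_⊎_; inj₁; inj₂)
open import Data.Sum.Function.Propositional using (_⊎-⇔_)
open import Data.Vec using (Vec; []; _∷_; lookup) renaming (tabulate to tabulateᵛ)
open import Data.Vec.Properties using (lookup∘tabulate)
open import Function using (_∘_; id; _⇔_; mk⇔; Equivalence)
open import Function.Properties.Equivalence using () renaming (refl to ⇔-refl; sym to ⇔-sym; trans to ⇔-trans)
open import Relation.Binary.Construct.Closure.ReflexiveTransitive as Star using (Star; ε; _◅_)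
open import Relation.Binary.Construct.Closure.Transitive as Plus using (TransClosure)
open import Relation.Binary.PropositionalEquality
  using (_≡_; _≢_; refl; sym; trans; cong; cong₂; subst; subst₂; module ≡-Reasoning)
open import Relation.Nullary using (¬_; Dec; yes; no)
open import Relation.Nullary.Decidable as Dec
  using (T?; ⌊_⌋; toWitness; fromWitness; ¬?; _×-dec_; _→-dec_)

private
  variable
    n : ℕ
    u v w : Fin n

Matrix : ℕ → Set
Matrix n = Vec (Vec Bool n) n

_[_,_] : Matrix n → Fin n → Fin n → Bool
M [ u , v ] = lookup (lookup M u) v

matrix : (Fin n → Fin n → Bool) → Matrix n
matrix f = tabulateᵛ (tabulateᵛ ∘ f)

matrix-entry : (f : Fin n → Fin n → Bool) → matrix f [ u , v ] ≡ f u v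
matrix-entry {u = u} {v} f rewrite lookup∘tabulate (tabulateᵛ ∘ f) u = lookup∘tabulate (f u) v

_==ᵇ_ : Bool → Bool → Bool
x ==ᵇ y = if x then y else not y

==ᵇ-sound : ∀ x y → T (x ==ᵇ y) → x ≡ y
==ᵇ-sound true true _ = refl
==ᵇ-sound false false _ = refl

sameVec : ∀ {A : Set} {k} → (A → A → Bool) → Vec A k → Vec A k → Bool
sameVec same [] [] = true
sameVec same (x ∷ xs) (y ∷ ys) = same x y ∧ sameVec same xs ys

sameVec-sound : ∀ {A : Set} {k} {same : A → A → Bool} → (∀ x y → T (same x y) → x ≡ y) →
                ∀ (xs ys : Vec A k) → T (sameVec same xs ys) → xs ≡ ys
sameVec-sound sound [] [] _ = refl
sameVec-sound {same = same} sound (x ∷ xs) (y ∷ ys) t with Equivalence.to (T-∧ {same x y}) t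
... | t₁ , t₂ = cong₂ _∷_ (sound x y t₁) (sameVec-sound sound xs ys t₂)

sameMatrix : Matrix n → Matrix n → Bool
sameMatrix = sameVec (sameVec _==ᵇ_)

sameMatrix-sound : ∀ (M N : Matrix n) → T (sameMatrix M N) → M ≡ N
sameMatrix-sound = sameVec-sound (sameVec-sound ==ᵇ-sound)

∃ᵇ : (Fin n → Bool) → Bool
∃ᵇ {zero} f = false
∃ᵇ {suc n} f = f zero ∨ ∃ᵇ (f ∘ suc)

T-∃ᵇ : {f : Fin n → Bool} → T (∃ᵇ f) ⇔ ∃ (T ∘ f)
T-∃ᵇ {zero} = mk⇔ (λ ()) λ ()
T-∃ᵇ {suc n} = ⇔-trans T-∨ (mk⇔
  (λ { (inj₁ t) → zero , t ; (inj₂ t) → Product.map suc id (Equivalence.to T-∃ᵇ t) })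
  (λ { (zero , t) → inj₁ t ; (suc w , t) → inj₂ (Equivalence.from T-∃ᵇ (w , t)) }))

T-not : ∀ {x} → T (not x) ⇔ (¬ T x)
T-not {true} = mk⇔ (λ ()) (λ ¬t → ¬t _)
T-not {false} = mk⇔ (λ _ ()) (λ _ → _)

record Adj (M : Matrix n) (u v : Fin n) : Set where
  constructor adj
  field entry : T (M [ u , v ])
open Adj

adj? : ∀ (M : Matrix n) u v → Dec (Adj M u v)
adj? M u v = Dec.map (mk⇔ adj entry) (T? (M [ u , v ]))

adj-matrix : (f : Fin n → Fin n → Bool) → Adj (matrix f) u v ⇔ T (f u v)
adj-matrix f = mk⇔ (subst T (matrix-entry f) ∘ entry) (adj ∘ subst T (sym (matrix-entry f)))

edgesFrom? : (M : Matrix n) (u : Fin n) → Dec (∃ (Adj M u))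
edgesFrom? M u = any? (adj? M u)

sameRow? : (M : Matrix n) (ν : Bool) (P : Matrix n) (u : Fin n) →
           Dec ((∀ v → M [ u , v ] ≡ P [ u , v ]) × (T ν → Adj P u u))
sameRow? M ν P u = all? (λ v → M [ u , v ] ≟ᵇ P [ u , v ]) ×-dec (T? ν →-dec adj? P u u)

disjointRow? : (M : Matrix n) (ν : Bool) (P : Matrix n) (u : Fin n) →
               Dec ((∀ v → ¬ (Adj M u v × Adj P u v)) × ¬ (T ν × Adj P u u))
disjointRow? M ν P u = all? (λ v → ¬? (adj? M u v ×-dec adj? P u v)) ×-dec ¬? (T? ν ×-dec adj? P u u)

∃ᵇ-∧-constant : ∀ (M : Matrix n) u {g : Fin n → Bool} {c} → (∀ w → g w ≡ c) →
                (∃ᵇ λ w → M [ u , w ] ∧ g w) ≡ ⌊ edgesFrom? M u ⌋ ∧ c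
∃ᵇ-∧-constant M u {g} {c} g≡c = ⇔→≡ {z = true} (⇔-trans (⇔-sym T-≡) (⇔-trans (mk⇔ to from) T-≡))
  where
    to : T (∃ᵇ λ w → M [ u , w ] ∧ g w) → T (⌊ edgesFrom? M u ⌋ ∧ c)
    to t with Equivalence.to T-∃ᵇ t
    ... | w , x with Equivalence.to (T-∧ {M [ u , w ]}) x
    ...   | y , z = Equivalence.from T-∧ (fromWitness (w , adj y) , subst T (g≡c w) z)
    from : T (⌊ edgesFrom? M u ⌋ ∧ c) → T (∃ᵇ λ w → M [ u , w ] ∧ g w)
    from t with Equivalence.to (T-∧ {⌊ edgesFrom? M u ⌋}) t
    ... | x , z with toWitness x
    ...   | w , adj y = Equivalence.from T-∃ᵇ (w , Equivalence.from T-∧ (y , subst T (sym (g≡c w)) z))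

infixl 6 _⊕_
infixl 7 _⊗_
infixr 8 _◃_

-- Opaque so that the arguments of the `adj-` lemmas can be inferred; the certificates below
-- unfold these definitions in order to compute.
opaque
  O : Matrix n
  O = matrix λ _ _ → false

  _⊕_ _⊗_ : Matrix n → Matrix n → Matrix n
  M ⊕ N = matrix λ u v → M [ u , v ] ∨ N [ u , v ]
  M ⊗ N = matrix λ u v → ∃ᵇ λ w → M [ u , w ] ∧ N [ w , v ]

  _ᵀ : Matrix n → Matrix n
  M ᵀ = matrix λ u v → M [ v , u ]

  ¬adj-O : ¬ Adj (O {n}) u v
  ¬adj-O = Equivalence.to (adj-matrix λ _ _ → false)

  adj-⊕ : {M N : Matrix n} → Adj (M ⊕ N) u v ⇔ (Adj M u v ⊎ Adj N u v)
  adj-⊕ {M = M} {N} = ⇔-trans (adj-matrix λ u v → M [ u , v ] ∨ N [ u , v ])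
    (⇔-trans T-∨ (mk⇔ (Sum.map adj adj) (Sum.map entry entry)))

  adj-⊗ : {M N : Matrix n} → Adj (M ⊗ N) u v ⇔ ∃ λ w → Adj M u w × Adj N w v
  adj-⊗ {M = M} {N} = ⇔-trans (adj-matrix λ u v → ∃ᵇ λ w → M [ u , w ] ∧ N [ w , v ])
    (⇔-trans T-∃ᵇ (mk⇔ (λ (w , t) → let (x , y) = Equivalence.to T-∧ t in w , adj x , adj y)
                       (λ (w , adj x , adj y) → w , Equivalence.from T-∧ (x , y))))

  adj-ᵀ : {M : Matrix n} → Adj (M ᵀ) u v ⇔ Adj M v u
  adj-ᵀ {M = M} = ⇔-trans (adj-matrix λ u v → M [ v , u ]) (mk⇔ adj entry)

_◃_ : Bool → Matrix n → Matrix n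
b ◃ M = if b then M else O

adj-◃ : ∀ b {M : Matrix n} → Adj (b ◃ M) u v ⇔ (T b × Adj M u v)
adj-◃ true = mk⇔ (λ t → _ , t) proj₂
adj-◃ false = mk⇔ (⊥-elim ∘ ¬adj-O) (λ ())

squarings : ℕ → Matrix n → Matrix n
squarings zero M = M
squarings (suc k) M = squarings k (M ⊕ M ⊗ M)

-- ⌈log₂ n⌉ squarings give the transitive closure. The argument never uses this, only
-- `PlusComplete`, which is checked on the finitely many matrices that occur.
plus : Matrix n → Matrix n
plus {n} = squarings ⌈log₂ n ⌉

PlusComplete : Matrix n → Set
PlusComplete M = ∀ u v → Adj (M ⊗ plus M) u v → Adj (plus M) u v

plusComplete? : (M : Matrix n) → Dec (PlusComplete M)
plusComplete? M = all? λ u → all? λ v → adj? (M ⊗ plus M) u v →-dec adj? (plus M) u v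

squarings-⊇ : ∀ k {M : Matrix n} → Adj M u v → Adj (squarings k M) u v
squarings-⊇ zero m = m
squarings-⊇ (suc k) m = squarings-⊇ k (Equivalence.from adj-⊕ (inj₁ m))

squarings-path : ∀ k {M N : Matrix n} → (∀ {u v} → Adj N u v → TransClosure (Adj M) u v) →
                 Adj (squarings k N) u v → TransClosure (Adj M) u v
squarings-path zero paths t = paths t
squarings-path (suc k) {M} {N} paths = squarings-path k square-paths
  where
    square-paths : Adj (N ⊕ N ⊗ N) u v → TransClosure (Adj M) u v
    square-paths t with Equivalence.to adj-⊕ t
    ... | inj₁ t₁ = paths t₁
    ... | inj₂ t₂ with Equivalence.to adj-⊗ t₂
    ...   | _ , t₃ , t₄ = paths t₃ Plus.++ paths t₄

⊆-plus : {M : Matrix n} → Adj M u v → Adj (plus M) u v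
⊆-plus {n} = squarings-⊇ ⌈log₂ n ⌉

plus-path : {M : Matrix n} → Adj (plus M) u v → TransClosure (Adj M) u v
plus-path {n} = squarings-path ⌈log₂ n ⌉ Plus.[_]

compose : Matrix n → Bool → Matrix n → Bool → Matrix n
compose M ν N μ = M ⊗ N ⊕ ν ◃ N ⊕ μ ◃ M

another : ∀ {K} → 2 ≤ K → Fin K → Fin K
another (s≤s (s≤s _)) i = punchIn i zero

another-≢ : ∀ {K} (2≤K : 2 ≤ K) i → another 2≤K i ≢ i
another-≢ (s≤s (s≤s _)) i = punchInᵢ≢i i zero

take-witnesses : ∀ {A : Set} {P : A → Set} {xs : List A} k → Unique xs → All P xs → k ≤ length xs →
                 ∃ λ ys → length ys ≡ k × Unique ys × All P ys
take-witnesses {xs = xs} k unique all k≤ =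
  take k xs , trans (length-take k xs) (m≤n⇒m⊓n≡m k≤) , Unique.take⁺ k unique , take⁺ k all

Bounded : ℕ → Shape → Set
Bounded N ⊤S = ⊤
Bounded N (const c) = c < N
Bounded N (φ ∧S ψ) = Bounded N φ × Bounded N ψ
Bounded N (φ ∨S ψ) = Bounded N φ × Bounded N ψ
Bounded N (¬S φ) = Bounded N φ
Bounded N (≥[ k ] E ∙ ψ) = 1 ≤ k × k ≤ N × Bounded N ψ
Bounded N (eqS E p) = ⊤
Bounded N (disjS E p) = ⊤
Bounded N (closedS R) = ⊤

BoundedFrom : ℕ → Shape → Set
BoundedFrom N ψ = ∀ {N′} → N ≤ N′ → Bounded N′ ψ

bounded-pair : ∀ {φ ψ} → ∃ (λ N → BoundedFrom N φ) → ∃ (λ N → BoundedFrom N ψ) →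
               ∃ λ N → ∀ {N′} → N ≤ N′ → Bounded N′ φ × Bounded N′ ψ
bounded-pair (N , bφ) (N′ , bψ) = N ⊔ N′ , λ le → bφ (≤-trans (m≤m⊔n N N′) le) , bψ (≤-trans (m≤n⊔m N N′) le)

bounded : ∀ {F} ψ → ShapeIn F ψ → ∃ λ N → BoundedFrom N ψ
bounded ⊤S _ = 0 , _
bounded (const c) _ = suc c , id
bounded (φ ∧S ψ) (iφ , iψ) = bounded-pair {φ} {ψ} (bounded φ iφ) (bounded ψ iψ)
bounded (φ ∨S ψ) (iφ , iψ) = bounded-pair {φ} {ψ} (bounded φ iφ) (bounded ψ iψ)
bounded (¬S φ) iφ = bounded φ iφ
bounded (≥[ k ] E ∙ ψ) (1≤k , iψ) with bounded ψ iψ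
... | N , bψ = k ⊔ N , λ le → 1≤k , ≤-trans (m≤m⊔n k N) le , bψ (≤-trans (m≤n⊔m k N) le)
bounded (eqS E p) _ = 0 , _
bounded (disjS E p) _ = 0 , _
bounded (closedS R) _ = 0 , _

BoundedSchema : ℕ → Schema → Set
BoundedSchema N S = All (λ (φ₁ , φ₂) → Bounded N φ₁ × Bounded N φ₂) S

bounded-schema : ∀ {F} S → InL F S → ∃ λ N → ∀ {N′} → N ≤ N′ → BoundedSchema N′ S
bounded-schema [] [] = 0 , λ _ → []
bounded-schema ((φ₁ , φ₂) ∷ S) ((i₁ , i₂) ∷ inL)
  with bounded-pair {φ₁} {φ₂} (bounded φ₁ i₁) (bounded φ₂ i₂) | bounded-schema S inL
... | N , b | N′ , bS = N ⊔ N′ , λ le → b (≤-trans (m≤m⊔n N N′) le) ∷ bS (≤-trans (m≤n⊔m N N′) le)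

nullable : PathExpr → Bool
nullable idE = true
nullable (prop p) = false
nullable (inv p) = false
nullable (E₁ ∪E E₂) = nullable E₁ ∨ nullable E₂
nullable (E₁ ∘E E₂) = nullable E₁ ∧ nullable E₂
nullable (star E) = true

nullable-⟦⟧ : ∀ E {G a} → T (nullable E) → ⟦ E ⟧E G a a
nullable-⟦⟧ idE _ = refl
nullable-⟦⟧ (E₁ ∪E E₂) ν with nullable E₁ in ν₁
... | true = inj₁ (nullable-⟦⟧ E₁ (subst T (sym ν₁) _))
... | false = inj₂ (nullable-⟦⟧ E₂ ν)
nullable-⟦⟧ (E₁ ∘E E₂) ν =
  let (ν₁ , ν₂) = Equivalence.to T-∧ ν in _ , nullable-⟦⟧ E₁ ν₁ , nullable-⟦⟧ E₂ ν₂
nullable-⟦⟧ (star E) _ = ε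

Isolated : Graph → Node → Set
Isolated G z = ∀ {p b} → (z , p , b) ∉ G × (b , p , z) ∉ G

isolated-⟦⟧ : ∀ {G z b} E → Isolated G z → ⟦ E ⟧E G z b → z ≡ b × T (nullable E)
isolated-⟦⟧ idE _ e = e , _
isolated-⟦⟧ (prop p) iso e = ⊥-elim (proj₁ iso e)
isolated-⟦⟧ (inv p) iso e = ⊥-elim (proj₂ iso e)
isolated-⟦⟧ (E₁ ∪E E₂) iso (inj₁ e) =
  Product.map₂ (λ t → Equivalence.from T-∨ (inj₁ t)) (isolated-⟦⟧ E₁ iso e)
isolated-⟦⟧ (E₁ ∪E E₂) iso (inj₂ e) =
  Product.map₂ (λ t → Equivalence.from T-∨ (inj₂ t)) (isolated-⟦⟧ E₂ iso e)
isolated-⟦⟧ (E₁ ∘E E₂) iso (c , e₁ , e₂) with isolated-⟦⟧ E₁ iso e₁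
... | refl , t₁ = Product.map₂ (λ t₂ → Equivalence.from T-∧ (t₁ , t₂)) (isolated-⟦⟧ E₂ iso e₂)
isolated-⟦⟧ (star E) iso ε = refl , _
isolated-⟦⟧ (star E) iso (e ◅ es) with isolated-⟦⟧ E iso e
... | refl , _ = isolated-⟦⟧ (star E) iso es

isolated-⊨ : ∀ {G G′ z} ψ → Isolated G z → Isolated G′ z → G , z ⊨ ψ → G′ , z ⊨ ψ
isolated-⊨ ⊤S _ _ s = s
isolated-⊨ (const c) _ _ s = s
isolated-⊨ (φ ∧S ψ) iso iso′ (s , t) = isolated-⊨ φ iso iso′ s , isolated-⊨ ψ iso iso′ t
isolated-⊨ (φ ∨S ψ) iso iso′ = Sum.map (isolated-⊨ φ iso iso′) (isolated-⊨ ψ iso iso′)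
isolated-⊨ (¬S φ) iso iso′ ¬s = ¬s ∘ isolated-⊨ φ iso′ iso
isolated-⊨ {G} {G′} {z} (≥[ k ] E ∙ ψ) iso iso′ (bs , len , unique , goods) = bs , len , unique , All.map good goods
  where
    good : ∀ {b} → ⟦ E ⟧E G z b × G , b ⊨ ψ → ⟦ E ⟧E G′ z b × G′ , b ⊨ ψ
    good (e , s) with isolated-⟦⟧ E iso e
    ... | refl , ν = nullable-⟦⟧ E ν , isolated-⊨ ψ iso iso′ s
isolated-⊨ {G′ = G′} {z} (eqS E p) iso iso′ s b = mk⇔ to (⊥-elim ∘ proj₁ iso′)
  where
    to : ⟦ E ⟧E G′ z b → (z , p , b) ∈ G′
    to e with isolated-⟦⟧ E iso′ e
    ... | refl , ν = ⊥-elim (proj₁ iso (Equivalence.to (s _) (nullable-⟦⟧ E ν)))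
isolated-⊨ (disjS E p) _ iso′ _ _ _ = proj₁ iso′
isolated-⊨ (closedS R) _ iso′ _ _ _ _ = proj₁ iso′

-- Blown-up block graphs

-- Entry (u, v) of τ E says that E leads from the nodes of block u to all nodes of block v
-- along a path with at least one edge; `nullable E` accounts for the empty path.
module BlockMatrix {n} (r : Prop) (A : Matrix n) where

  edgeMatrix : Prop → Matrix n
  edgeMatrix p with p ≟ r
  ... | yes _ = A
  ... | no _ = O

  edgeMatrix-self : edgeMatrix r ≡ A
  edgeMatrix-self with r ≟ r
  ... | yes _ = refl
  ... | no r≢r = ⊥-elim (r≢r refl)

  τ : PathExpr → Matrix n
  τ idE = O
  τ (prop p) = edgeMatrix p
  τ (inv p) = edgeMatrix p ᵀ
  τ (E₁ ∪E E₂) = τ E₁ ⊕ τ E₂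
  τ (E₁ ∘E E₂) = compose (τ E₁) (nullable E₁) (τ E₂) (nullable E₂)
  τ (star E) = plus (τ E)

-- The offset m keeps the nodes above the constants of a schema.
module BlowUp {n} (K m r : ℕ) (A : Matrix n) where
  open BlockMatrix r A public

  node : Fin n → Fin K → Node
  node u i = m + toℕ (combine u i)

  node-injective : ∀ {u i v j} → node u i ≡ node v j → u ≡ v × i ≡ j
  node-injective e = combine-injective _ _ _ _ (toℕ-injective (+-cancelˡ-≡ m _ _ e))

  Cell : Set
  Cell = Fin n × Fin K

  cells : List Cell
  cells = cartesianProduct (allFin n) (allFin K)

  link : Cell × Cell → Triple
  link ((u , i) , (v , j)) = node u i , r , node v j

  Linked : Cell × Cell → Set
  Linked ((u , _) , (v , _)) = Adj A u v

  linked? : ∀ c → Dec (Linked c)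
  linked? ((u , _) , (v , _)) = adj? A u v

  G : Graph
  G = map link (filter linked? (cartesianProduct cells cells))

  data BlockRel (M : Matrix n) (ν : Bool) (a b : Node) : Set where
    stay : T ν → a ≡ b → BlockRel M ν a b
    jump : ∀ {u i v j} → a ≡ node u i → b ≡ node v j → Adj M u v → BlockRel M ν a b

  private
    variable
      M N : Matrix n
      ν μ : Bool
      a b : Node

  BlockRel-O : BlockRel O ν a b → T ν × a ≡ b
  BlockRel-O (stay t e) = t , e
  BlockRel-O (jump _ _ x) = ⊥-elim (¬adj-O x)

  BlockRel-⊕ : BlockRel (M ⊕ N) (ν ∨ μ) a b ⇔ (BlockRel M ν a b ⊎ BlockRel N μ a b)
  BlockRel-⊕ = mk⇔ to from
    where
      to : BlockRel (M ⊕ N) (ν ∨ μ) a b → BlockRel M ν a b ⊎ BlockRel N μ a b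
      to (stay t e) = Sum.map (λ t → stay t e) (λ t → stay t e) (Equivalence.to T-∨ t)
      to (jump ea eb x) = Sum.map (jump ea eb) (jump ea eb) (Equivalence.to adj-⊕ x)
      from : BlockRel M ν a b ⊎ BlockRel N μ a b → BlockRel (M ⊕ N) (ν ∨ μ) a b
      from (inj₁ (stay t e)) = stay (Equivalence.from T-∨ (inj₁ t)) e
      from (inj₁ (jump ea eb x)) = jump ea eb (Equivalence.from adj-⊕ (inj₁ x))
      from (inj₂ (stay t e)) = stay (Equivalence.from T-∨ (inj₂ t)) e
      from (inj₂ (jump ea eb x)) = jump ea eb (Equivalence.from adj-⊕ (inj₂ x))

  BlockRel-ᵀ : BlockRel (M ᵀ) ν a b ⇔ BlockRel M ν b a
  BlockRel-ᵀ = mk⇔ (λ { (stay t e) → stay t (sym e) ; (jump ea eb x) → jump eb ea (Equivalence.to adj-ᵀ x) })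
                   (λ { (stay t e) → stay t (sym e) ; (jump ea eb x) → jump eb ea (Equivalence.from adj-ᵀ x) })

  BlockRel-compose : BlockRel (compose M ν N μ) (ν ∧ μ) a b ⇔ ∃ λ c → BlockRel M ν a c × BlockRel N μ c b
  BlockRel-compose {M = M} {ν = ν} {N = N} {μ = μ} = mk⇔ to from
    where
      via-⊗ : Adj (M ⊗ N) u v → Adj (compose M ν N μ) u v
      via-⊗ x = Equivalence.from adj-⊕ (inj₁ (Equivalence.from adj-⊕ (inj₁ x)))
      via-ν : T ν → Adj N u v → Adj (compose M ν N μ) u v
      via-ν t x = Equivalence.from adj-⊕ (inj₁ (Equivalence.from adj-⊕ (inj₂ (Equivalence.from (adj-◃ ν) (t , x)))))
      via-μ : T μ → Adj M u v → Adj (compose M ν N μ) u v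
      via-μ t x = Equivalence.from adj-⊕ (inj₂ (Equivalence.from (adj-◃ μ) (t , x)))
      to : BlockRel (compose M ν N μ) (ν ∧ μ) a b → ∃ λ c → BlockRel M ν a c × BlockRel N μ c b
      to (stay t e) = let (t₁ , t₂) = Equivalence.to T-∧ t in _ , stay t₁ refl , stay t₂ e
      to (jump {i = i} ea eb x) with Equivalence.to adj-⊕ x
      ... | inj₂ y = let (t , z) = Equivalence.to (adj-◃ μ) y in _ , jump ea eb z , stay t refl
      ... | inj₁ y with Equivalence.to adj-⊕ y
      ...   | inj₂ z = let (t , z′) = Equivalence.to (adj-◃ ν) z in _ , stay t refl , jump ea eb z′
      ...   | inj₁ z = let (w , z₁ , z₂) = Equivalence.to adj-⊗ z in node w i , jump ea refl z₁ , jump refl eb z₂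
      from : (∃ λ c → BlockRel M ν a c × BlockRel N μ c b) → BlockRel (compose M ν N μ) (ν ∧ μ) a b
      from (_ , stay t₁ refl , stay t₂ e) = stay (Equivalence.from T-∧ (t₁ , t₂)) e
      from (_ , stay t refl , jump ec eb x) = jump ec eb (via-ν t x)
      from (_ , jump ea ec x , stay t refl) = jump ea ec (via-μ t x)
      from (_ , jump ea ec x , jump ec′ eb y) with node-injective (trans (sym ec) ec′)
      ... | refl , refl = jump ea eb (via-⊗ (Equivalence.from adj-⊗ (_ , x , y)))

  lift-path : TransClosure (Adj M) u v → ∀ {i j} → Star (BlockRel M ν) (node u i) (node v j)
  lift-path Plus.[ x ] = jump refl refl x ◅ ε
  lift-path (x Plus.∷ xs) {i} = jump {j = i} refl refl x ◅ lift-path xs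

  BlockRel-plus : PlusComplete M → BlockRel (plus M) true a b ⇔ Star (BlockRel M ν) a b
  BlockRel-plus {M = M} {ν = ν} complete = mk⇔ to from
    where
      to : BlockRel (plus M) true a b → Star (BlockRel M ν) a b
      to (stay _ refl) = ε
      to (jump refl refl x) = lift-path (plus-path x)
      from : Star (BlockRel M ν) a b → BlockRel (plus M) true a b
      from ε = stay _ refl
      from (stay _ refl ◅ steps) = from steps
      from (jump ea ec x ◅ steps) with from steps
      ... | stay _ refl = jump ea ec (⊆-plus x)
      ... | jump ec′ eb y with node-injective (trans (sym ec) ec′)
      ...   | refl , refl = jump ea eb (complete _ _ (Equivalence.from adj-⊗ (_ , x , y)))

  BlockRel-from : ∀ {u i} → BlockRel M ν (node u i) b →
                  (T ν × b ≡ node u i) ⊎ ∃ λ v → ∃ λ j → b ≡ node v j × Adj M u v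
  BlockRel-from (stay t e) = inj₁ (t , sym e)
  BlockRel-from (jump ea eb x) with node-injective ea
  ... | refl , refl = inj₂ (_ , _ , eb , x)

  adj-edgeMatrix : ∀ p → Adj (edgeMatrix p) u v ⇔ (p ≡ r × Adj A u v)
  adj-edgeMatrix p with p ≟ r
  ... | yes p≡r = mk⇔ (p≡r ,_) proj₂
  ... | no p≢r = mk⇔ (⊥-elim ∘ ¬adj-O) (⊥-elim ∘ p≢r ∘ proj₁)

  ∈G⇔BlockRel : ∀ {p} → (a , p , b) ∈ G ⇔ BlockRel (edgeMatrix p) false a b
  ∈G⇔BlockRel {a} {b} {p} = mk⇔ to from
    where
      to : (a , p , b) ∈ G → BlockRel (edgeMatrix p) false a b
      to t∈G with ∈-map⁻ link t∈G
      ... | _ , c∈ , refl = jump refl refl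
        (Equivalence.from (adj-edgeMatrix r) (refl , proj₂ (∈-filter⁻ linked? {xs = cartesianProduct cells cells} c∈)))
      from : BlockRel (edgeMatrix p) false a b → (a , p , b) ∈ G
      from (jump {u} {i} {v} {j} refl refl x) with Equivalence.to (adj-edgeMatrix p) x
      ... | refl , y = ∈-map⁺ link (∈-filter⁺ linked? (∈-cartesianProduct⁺ (cell∈ u i) (cell∈ v j)) y)
        where
          cell∈ : ∀ u i → (u , i) ∈ cells
          cell∈ u i = ∈-cartesianProduct⁺ (∈-allFin u) (∈-allFin i)

  outside-isolated : ∀ {z} → ¬ (∃ λ u → ∃ λ i → z ≡ node u i) → Isolated G z
  outside-isolated {z} outside =
    out ∘ Equivalence.to ∈G⇔BlockRel , out ∘ Equivalence.from BlockRel-ᵀ ∘ Equivalence.to ∈G⇔BlockRel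
    where
      out : ∀ {b M} → BlockRel M false z b → ⊥
      out (jump ez _ _) = outside (_ , _ , ez)

  ⟦⟧⇔BlockRel : (∀ E → PlusComplete (τ E)) → ∀ E → ⟦ E ⟧E G a b ⇔ BlockRel (τ E) (nullable E) a b
  ⟦⟧⇔BlockRel complete idE = mk⇔ (stay _) (proj₂ ∘ BlockRel-O)
  ⟦⟧⇔BlockRel complete (prop p) = ∈G⇔BlockRel
  ⟦⟧⇔BlockRel complete (inv p) = ⇔-trans ∈G⇔BlockRel (⇔-sym BlockRel-ᵀ)
  ⟦⟧⇔BlockRel complete (E₁ ∪E E₂) =
    ⇔-trans (⟦⟧⇔BlockRel complete E₁ ⊎-⇔ ⟦⟧⇔BlockRel complete E₂) (⇔-sym BlockRel-⊕)
  ⟦⟧⇔BlockRel {a} {b} complete (E₁ ∘E E₂) = ⇔-trans (mk⇔ to from) (⇔-sym BlockRel-compose)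
    where
      IH : ∀ E {a b} → ⟦ E ⟧E G a b ⇔ BlockRel (τ E) (nullable E) a b
      IH E = ⟦⟧⇔BlockRel complete E
      Via : Node → Set
      Via c = BlockRel (τ E₁) (nullable E₁) a c × BlockRel (τ E₂) (nullable E₂) c b
      to : ⟦ E₁ ∘E E₂ ⟧E G a b → ∃ Via
      to (c , e₁ , e₂) = c , Equivalence.to (IH E₁) e₁ , Equivalence.to (IH E₂) e₂
      from : ∃ Via → ⟦ E₁ ∘E E₂ ⟧E G a b
      from (c , s₁ , s₂) = c , Equivalence.from (IH E₁) s₁ , Equivalence.from (IH E₂) s₂
  ⟦⟧⇔BlockRel complete (star E) =
    ⇔-trans (mk⇔ (Star.map (Equivalence.to IH)) (Star.map (Equivalence.from IH))) (⇔-sym (BlockRel-plus (complete E)))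
    where
      IH : ∀ {a b} → ⟦ E ⟧E G a b ⇔ BlockRel (τ E) (nullable E) a b
      IH = ⟦⟧⇔BlockRel complete E

  r-edge⇔ : (a , r , b) ∈ G ⇔ BlockRel A false a b
  r-edge⇔ = ⇔-trans ∈G⇔BlockRel (mk⇔
    (λ { (jump ea eb x) → jump ea eb (proj₂ (Equivalence.to (adj-edgeMatrix r) x)) })
    (λ { (jump ea eb x) → jump ea eb (Equivalence.from (adj-edgeMatrix r) (refl , x)) }))

  r-edge : ∀ {u v} i j → Adj A u v → (node u i , r , node v j) ∈ G
  r-edge i j x = Equivalence.from r-edge⇔ (jump refl refl x)

  r-edge-from : ∀ {u i b} → (node u i , r , b) ∈ G → ∃ λ v → ∃ λ j → b ≡ node v j × Adj A u v
  r-edge-from e with BlockRel-from (Equivalence.to r-edge⇔ e)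
  ... | inj₂ target = target

  symmetric⇒Q-eq : (∀ {u v} → Adj A u v → Adj A v u) → Q eq r G
  symmetric⇒Q-eq symmetric a b e with Equivalence.to r-edge⇔ e
  ... | jump refl refl x = r-edge _ _ (symmetric x)

  asymmetric⇒¬Q-eq : ∀ {u v} → Fin K → Adj A u v → ¬ Adj A v u → ¬ Q eq r G
  asymmetric⇒¬Q-eq i x ¬y q with r-edge-from (q _ _ (r-edge i i x))
  ... | _ , _ , e , y with node-injective e
  ...   | refl , refl = ¬y y

  mutual⇒Q-disj : (∀ {u v} → Adj A u v → ∃ λ w → Adj A u w × Adj A w u) → Q disj r G
  mutual⇒Q-disj partner a b e with Equivalence.to r-edge⇔ e
  ... | jump {i = i} refl refl x with partner x
  ...   | w , y , y′ = node w i , r-edge i i y , r-edge i i y′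

  lonely⇒¬Q-disj : ∀ {u v} → Fin K → Adj A u v → (∀ w → Adj A u w → ¬ Adj A w u) → ¬ Q disj r G
  lonely⇒¬Q-disj i x lonely q with q _ _ (r-edge i i x)
  ... | c , e₁ , e₂ with r-edge-from e₁
  ...   | w , j , refl , y with r-edge-from e₂
  ...     | _ , _ , e , y′ with node-injective e
  ...       | refl , refl = lonely w y y′

  sameRow⇔ : 2 ≤ K → ∀ {P u i} →
             (∀ b → BlockRel M ν (node u i) b ⇔ BlockRel P false (node u i) b) ⇔
             ((∀ v → M [ u , v ] ≡ P [ u , v ]) × (T ν → Adj P u u))
  sameRow⇔ {M} {ν} 2≤K {P} {u} {i} = mk⇔ to from
    where
      z : Node
      z = node u i
      SameTargets SameRow : Set
      SameTargets = ∀ b → BlockRel M ν z b ⇔ BlockRel P false z b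
      SameRow = (∀ v → M [ u , v ] ≡ P [ u , v ]) × (T ν → Adj P u u)
      to : SameTargets → SameRow
      to h = (λ v → ⇔→≡ {z = true} (⇔-trans (⇔-sym T-≡) (⇔-trans (mk⇔ (M⇒P v) (P⇒M v)) T-≡))) , ν⇒P
        where
          M⇒P : ∀ v → T (M [ u , v ]) → T (P [ u , v ])
          M⇒P v x with BlockRel-from (Equivalence.to (h _) (jump {j = i} refl refl (adj x)))
          ... | inj₂ (_ , _ , e , y) with node-injective e
          ...   | refl , refl = entry y
          -- Aim at a copy of u other than z, so that the empty path of E cannot reach it.
          P⇒M : ∀ v → T (P [ u , v ]) → T (M [ u , v ])
          P⇒M v x with BlockRel-from (Equivalence.from (h _) (jump {j = another 2≤K i} refl refl (adj x)))
          ... | inj₁ (_ , e) = ⊥-elim (another-≢ 2≤K i (proj₂ (node-injective e)))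
          ... | inj₂ (_ , _ , e , y) with node-injective e
          ...   | refl , refl = entry y
          ν⇒P : T ν → Adj P u u
          ν⇒P t with BlockRel-from (Equivalence.to (h z) (stay t refl))
          ... | inj₂ (_ , _ , e , y) with node-injective e
          ...   | refl , refl = y
      from : SameRow → SameTargets
      from (same , ν⇒P) b = mk⇔ M⇒P P⇒M
        where
          M⇒P : BlockRel M ν z b → BlockRel P false z b
          M⇒P s with BlockRel-from s
          ... | inj₁ (t , refl) = jump refl refl (ν⇒P t)
          ... | inj₂ (v , _ , refl , adj x) = jump refl refl (adj (subst T (same v) x))
          P⇒M : BlockRel P false z b → BlockRel M ν z b
          P⇒M s with BlockRel-from s
          ... | inj₂ (v , _ , refl , adj x) = jump refl refl (adj (subst T (sym (same v)) x))

  disjointRow⇔ : ∀ {P u i} →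
                 (∀ b → BlockRel M ν (node u i) b → BlockRel P false (node u i) b → ⊥) ⇔
                 ((∀ v → ¬ (Adj M u v × Adj P u v)) × ¬ (T ν × Adj P u u))
  disjointRow⇔ {M} {ν} {P} {u} {i} = mk⇔ to from
    where
      z : Node
      z = node u i
      DisjointTargets DisjointRow : Set
      DisjointTargets = ∀ b → BlockRel M ν z b → BlockRel P false z b → ⊥
      DisjointRow = (∀ v → ¬ (Adj M u v × Adj P u v)) × ¬ (T ν × Adj P u u)
      to : DisjointTargets → DisjointRow
      to h = (λ v (x , y) → h (node v i) (jump refl refl x) (jump refl refl y)) ,
             (λ (t , y) → h z (stay t refl) (jump refl refl y))
      from : DisjointRow → DisjointTargets
      from (apart , ¬self) b s s′ with BlockRel-from s | BlockRel-from s′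
      ... | inj₁ (t , refl) | inj₂ (_ , _ , e , y) with node-injective e
      ...   | refl , refl = ¬self (t , y)
      from (apart , ¬self) b s s′ | inj₂ (v , _ , refl , x) | inj₂ (_ , _ , e , y) with node-injective e
      ...   | refl , refl = apart v (x , y)

  -- For ≥ₖ only existence of a qualifying target block matters: a block has K ≥ k nodes.
  eval : Shape → Fin n → Bool
  eval ⊤S u = true
  eval (const c) u = false
  eval (φ ∧S ψ) u = eval φ u ∧ eval ψ u
  eval (φ ∨S ψ) u = eval φ u ∨ eval ψ u
  eval (¬S φ) u = not (eval φ u)
  eval (≥[ k ] E ∙ ψ) u = (∃ᵇ λ v → τ E [ u , v ] ∧ eval ψ v) ∨ (nullable E ∧ eval ψ u ∧ (k ≤ᵇ 1))
  eval (eqS E p) u = ⌊ sameRow? (τ E) (nullable E) (edgeMatrix p) u ⌋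
  eval (disjS E p) u = ⌊ disjointRow? (τ E) (nullable E) (edgeMatrix p) u ⌋
  eval (closedS R) u = not ⌊ edgesFrom? A u ⌋ ∨ ⌊ r ∈? R ⌋

  module Evaluation (complete : ∀ E → PlusComplete (τ E)) (2≤K : 2 ≤ K) (K≤m : K ≤ m) where

    ⟦⟧⇔ : ∀ E → ⟦ E ⟧E G a b ⇔ BlockRel (τ E) (nullable E) a b
    ⟦⟧⇔ = ⟦⟧⇔BlockRel complete

    ⊨≥⇔eval : ∀ {k E ψ u i} → 1 ≤ k → k ≤ K → (∀ {v j} → G , node v j ⊨ ψ ⇔ T (eval ψ v)) →
              G , node u i ⊨ (≥[ k ] E ∙ ψ) ⇔ T (eval (≥[ k ] E ∙ ψ) u)
    ⊨≥⇔eval {k} {E} {ψ} {u} {i} 1≤k k≤K ⊨ψ⇔ = mk⇔ to from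
      where
        z : Node
        z = node u i
        Good : Node → Set
        Good b = ⟦ E ⟧E G z b × (G , b ⊨ ψ)
        classify : ∀ {b} → Good b →
                   (T (nullable E) × b ≡ z × T (eval ψ u)) ⊎ T (∃ᵇ λ v → τ E [ u , v ] ∧ eval ψ v)
        classify (e , s) with BlockRel-from (Equivalence.to (⟦⟧⇔ E) e)
        ... | inj₁ (t , refl) = inj₁ (t , refl , Equivalence.to ⊨ψ⇔ s)
        ... | inj₂ (v , j , refl , x) =
          inj₂ (Equivalence.from T-∃ᵇ (v , Equivalence.from T-∧ (entry x , Equivalence.to ⊨ψ⇔ s)))
        to : G , z ⊨ (≥[ k ] E ∙ ψ) → T (eval (≥[ k ] E ∙ ψ) u)
        to (_ ∷ [] , refl , _ , g ∷ []) with classify g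
        ... | inj₁ (t , _ , s) = Equivalence.from T-∨ (inj₂ (Equivalence.from T-∧ (t , Equivalence.from T-∧ (s , _))))
        ... | inj₂ x = Equivalence.from T-∨ (inj₁ x)
        to (_ ∷ _ ∷ _ , _ , (b≢b′ ∷ _) ∷ _ , g ∷ g′ ∷ _) with classify g | classify g′
        ... | inj₂ x | _ = Equivalence.from T-∨ (inj₁ x)
        ... | inj₁ _ | inj₂ x = Equivalence.from T-∨ (inj₁ x)
        ... | inj₁ (_ , refl , _) | inj₁ (_ , refl , _) = ⊥-elim (b≢b′ refl)
        from : T (eval (≥[ k ] E ∙ ψ) u) → G , z ⊨ (≥[ k ] E ∙ ψ)
        from t with Equivalence.to T-∨ t
        ... | inj₁ x with Equivalence.to T-∃ᵇ x
        ...   | v , y = let (x₁ , x₂) = Equivalence.to T-∧ y in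
          take-witnesses k (Unique.tabulate⁺ (proj₂ ∘ node-injective))
            (tabulate⁺ λ j → Equivalence.from (⟦⟧⇔ E) (jump refl refl (adj x₁)) , Equivalence.from ⊨ψ⇔ x₂)
            (subst (k ≤_) (sym (length-tabulate (node v))) k≤K)
        from t | inj₂ y with Equivalence.to (T-∧ {nullable E}) y
        ... | ν , y′ with Equivalence.to (T-∧ {eval ψ u}) y′
        ...   | s , k≤1 with ≤-antisym (≤ᵇ⇒≤ k 1 k≤1) 1≤k
        ...     | refl = z ∷ [] , refl , [] ∷ [] , (nullable-⟦⟧ E ν , Equivalence.from ⊨ψ⇔ s) ∷ []

    ⊨eq⇔eval : ∀ {E p u i} → G , node u i ⊨ eqS E p ⇔ T (eval (eqS E p) u)
    ⊨eq⇔eval {E} = mk⇔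
      (λ s → fromWitness (Equivalence.to (sameRow⇔ 2≤K) λ b →
        ⇔-trans (⇔-sym (⟦⟧⇔ E)) (⇔-trans (s b) ∈G⇔BlockRel)))
      (λ t b → ⇔-trans (⟦⟧⇔ E) (⇔-trans (Equivalence.from (sameRow⇔ 2≤K) (toWitness t) b) (⇔-sym ∈G⇔BlockRel)))

    ⊨disj⇔eval : ∀ {E p u i} → G , node u i ⊨ disjS E p ⇔ T (eval (disjS E p) u)
    ⊨disj⇔eval {E} = mk⇔
      (λ s → fromWitness (Equivalence.to disjointRow⇔ λ b e e′ →
        s b (Equivalence.from (⟦⟧⇔ E) e) (Equivalence.from ∈G⇔BlockRel e′)))
      (λ t b e e′ → Equivalence.from disjointRow⇔ (toWitness t) b
        (Equivalence.to (⟦⟧⇔ E) e) (Equivalence.to ∈G⇔BlockRel e′))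

    ⊨closed⇔eval : ∀ {R u i} → G , node u i ⊨ closedS R ⇔ T (eval (closedS R) u)
    ⊨closed⇔eval {R} {u} {i} = mk⇔ to from
      where
        to : G , node u i ⊨ closedS R → T (eval (closedS R) u)
        to s with r ∈? R
        ... | yes _ = Equivalence.from (T-∨ {not ⌊ edgesFrom? A u ⌋}) (inj₂ _)
        ... | no r∉R = Equivalence.from (T-∨ {not ⌊ edgesFrom? A u ⌋}) (inj₁ (Equivalence.from T-not λ t →
          let (v , x) = toWitness {a? = edgesFrom? A u} t in s r (node v i) r∉R (r-edge i i x)))
        from : T (eval (closedS R) u) → G , node u i ⊨ closedS R
        from t p b p∉R e with BlockRel-from (Equivalence.to ∈G⇔BlockRel e)
        ... | inj₂ (v , _ , _ , x)
          with Equivalence.to (adj-edgeMatrix p) x | Equivalence.to (T-∨ {not ⌊ edgesFrom? A u ⌋}) t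
        ...   | refl , y | inj₁ noEdges = Equivalence.to T-not noEdges (fromWitness (v , y))
        ...   | refl , _ | inj₂ r∈R = p∉R (toWitness r∈R)

    node≢const : ∀ {c u i} → c < K → node u i ≢ c
    node≢const c<K e = <⇒≢ (<-≤-trans c<K (≤-trans K≤m (m≤m+n m _))) (sym e)

    ⊨⇔eval : ∀ ψ → Bounded K ψ → ∀ {u i} → G , node u i ⊨ ψ ⇔ T (eval ψ u)
    ⊨⇔eval ⊤S _ = mk⇔ _ _
    ⊨⇔eval (const c) c<K = mk⇔ (⊥-elim ∘ node≢const c<K) λ ()
    ⊨⇔eval (φ ∧S ψ) (bφ , bψ) = ⇔-trans (⊨⇔eval φ bφ ×-⇔ ⊨⇔eval ψ bψ) (⇔-sym T-∧)
    ⊨⇔eval (φ ∨S ψ) (bφ , bψ) = ⇔-trans (⊨⇔eval φ bφ ⊎-⇔ ⊨⇔eval ψ bψ) (⇔-sym T-∨)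
    ⊨⇔eval (¬S φ) bφ = ⇔-trans (mk⇔ (λ ¬s → ¬s ∘ Equivalence.from φ⇔) (λ ¬t → ¬t ∘ Equivalence.to φ⇔)) (⇔-sym T-not)
      where
        φ⇔ : ∀ {u i} → G , node u i ⊨ φ ⇔ T (eval φ u)
        φ⇔ = ⊨⇔eval φ bφ
    ⊨⇔eval (≥[ k ] E ∙ ψ) (1≤k , k≤K , bψ) = ⊨≥⇔eval 1≤k k≤K (⊨⇔eval ψ bψ)
    ⊨⇔eval (eqS E p) _ = ⊨eq⇔eval
    ⊨⇔eval (disjS E p) _ = ⊨disj⇔eval
    ⊨⇔eval (closedS R) _ = ⊨closed⇔eval

module Transfer {n₁ n₂} (K m r : ℕ) (A₁ : Matrix n₁) (A₂ : Matrix n₂) (F : FeatureSet) where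
  module B₁ = BlowUp K m r A₁
  module B₂ = BlowUp K m r A₂

  record Indistinguishable : Set where
    field
      complete₁ : ∀ E → PlusComplete (B₁.τ E)
      complete₂ : ∀ E → PlusComplete (B₂.τ E)
      edgesFrom-agree : ∀ E u v → ⌊ edgesFrom? (B₁.τ E) u ⌋ ≡ ⌊ edgesFrom? (B₂.τ E) v ⌋
      sameRow-agree : F eq ≡ true → ∀ E p u v → B₁.eval (eqS E p) u ≡ B₂.eval (eqS E p) v
      disjointRow-agree : F disj ≡ true → ∀ E p u v → B₁.eval (disjS E p) u ≡ B₂.eval (disjS E p) v

  node-embed : (n₁≤n₂ : n₁ ≤ n₂) → ∀ u j → B₁.node u j ≡ B₂.node (inject≤ u n₁≤n₂) j
  node-embed n₁≤n₂ u j = cong (m +_) (begin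
    toℕ (combine u j)                  ≡⟨ toℕ-combine u j ⟩
    K * toℕ u + toℕ j                  ≡⟨ cong (λ t → K * t + toℕ j) (sym (toℕ-inject≤ u n₁≤n₂)) ⟩
    K * toℕ (inject≤ u n₁≤n₂) + toℕ j  ≡⟨ toℕ-combine (inject≤ u n₁≤n₂) j ⟨
    toℕ (combine (inject≤ u n₁≤n₂) j)  ∎)
    where open ≡-Reasoning

  module _ (I : Indistinguishable) where
    open Indistinguishable I

    eval-agree : ∀ ψ → ShapeIn F ψ → ∀ u v → B₁.eval ψ u ≡ B₂.eval ψ v
    eval-agree ⊤S _ u v = refl
    eval-agree (const c) _ u v = refl
    eval-agree (φ ∧S ψ) (iφ , iψ) u v = cong₂ _∧_ (eval-agree φ iφ u v) (eval-agree ψ iψ u v)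
    eval-agree (φ ∨S ψ) (iφ , iψ) u v = cong₂ _∨_ (eval-agree φ iφ u v) (eval-agree ψ iψ u v)
    eval-agree (¬S φ) iφ u v = cong not (eval-agree φ iφ u v)
    eval-agree (≥[ k ] E ∙ ψ) (_ , iψ) u v = begin
      (∃ᵇ λ w → B₁.τ E [ u , w ] ∧ B₁.eval ψ w) ∨ (nullable E ∧ B₁.eval ψ u ∧ (k ≤ᵇ 1))
        ≡⟨ cong₂ (λ x y → x ∨ (nullable E ∧ y ∧ (k ≤ᵇ 1))) (∃ᵇ-∧-constant (B₁.τ E) u ψ₁≡c) (ψ₁≡c u) ⟩
      (⌊ edgesFrom? (B₁.τ E) u ⌋ ∧ c) ∨ (nullable E ∧ c ∧ (k ≤ᵇ 1))
        ≡⟨ cong (λ x → (x ∧ c) ∨ (nullable E ∧ c ∧ (k ≤ᵇ 1))) (edgesFrom-agree E u v) ⟩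
      (⌊ edgesFrom? (B₂.τ E) v ⌋ ∧ c) ∨ (nullable E ∧ c ∧ (k ≤ᵇ 1))
        ≡⟨ cong₂ (λ x y → x ∨ (nullable E ∧ y ∧ (k ≤ᵇ 1))) (∃ᵇ-∧-constant (B₂.τ E) v ψ₂≡c) (ψ₂≡c v) ⟨
      (∃ᵇ λ w → B₂.τ E [ v , w ] ∧ B₂.eval ψ w) ∨ (nullable E ∧ B₂.eval ψ v ∧ (k ≤ᵇ 1)) ∎
      where
        open ≡-Reasoning
        c : Bool
        c = B₁.eval ψ u
        ψ₁≡c : ∀ w → B₁.eval ψ w ≡ c
        ψ₁≡c w = trans (eval-agree ψ iψ w v) (sym (eval-agree ψ iψ u v))
        ψ₂≡c : ∀ w → B₂.eval ψ w ≡ c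
        ψ₂≡c w = sym (eval-agree ψ iψ u w)
    eval-agree (eqS E p) F∋eq u v = sameRow-agree F∋eq E p u v
    eval-agree (disjS E p) F∋disj u v = disjointRow-agree F∋disj E p u v
    eval-agree (closedS R) _ u v =
      cong (λ x → not x ∨ ⌊ r ∈? R ⌋) (subst₂ (λ M₁ M₂ → ⌊ edgesFrom? M₁ u ⌋ ≡ ⌊ edgesFrom? M₂ v ⌋)
        B₁.edgeMatrix-self B₂.edgeMatrix-self (edgesFrom-agree (prop r) u v))

    module _ (n₁≤n₂ : n₁ ≤ n₂) (u₀ : Fin n₁) (2≤K : 2 ≤ K) (K≤m : K ≤ m) where
      open B₁.Evaluation complete₁ 2≤K K≤m using () renaming (⊨⇔eval to ⊨₁⇔eval)
      open B₂.Evaluation complete₂ 2≤K K≤m using () renaming (⊨⇔eval to ⊨₂⇔eval)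

      inclusion-transfer : ∀ {φ₁ φ₂} → ShapeIn F φ₁ → ShapeIn F φ₂ → Bounded K φ₁ → Bounded K φ₂ →
                           (∀ a → B₁.G , a ⊨ φ₁ → B₁.G , a ⊨ φ₂) → ∀ z → B₂.G , z ⊨ φ₁ → B₂.G , z ⊨ φ₂
      inclusion-transfer {φ₁} {φ₂} i₁ i₂ b₁ b₂ incl z s with any? (λ u → any? (λ j → z ≟ B₂.node u j))
      ... | yes (v , j , refl) =
        Equivalence.from (⊨₂⇔eval φ₂ b₂) (subst T (eval-agree φ₂ i₂ u₀ v)
          (Equivalence.to (⊨₁⇔eval φ₂ b₂) (incl _ (Equivalence.from (⊨₁⇔eval φ₁ b₁ {u₀} {j})
            (subst T (sym (eval-agree φ₁ i₁ u₀ v)) (Equivalence.to (⊨₂⇔eval φ₁ b₁) s))))))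
      ... | no outside₂ = isolated-⊨ φ₂ iso₁ iso₂ (incl z (isolated-⊨ φ₁ iso₂ iso₁ s))
        where
          iso₂ : Isolated B₂.G z
          iso₂ = B₂.outside-isolated outside₂
          iso₁ : Isolated B₁.G z
          iso₁ = B₁.outside-isolated λ (u , j , e) →
            outside₂ (inject≤ u n₁≤n₂ , j , trans e (node-embed n₁≤n₂ u j))

      conforms-transfer : ∀ S → InL F S → BoundedSchema K S → Conforms B₁.G S → Conforms B₂.G S
      conforms-transfer [] [] [] [] = []
      conforms-transfer (_ ∷ S) ((i₁ , i₂) ∷ inL) ((b₁ , b₂) ∷ bS) (incl ∷ conf) =
        inclusion-transfer i₁ i₂ b₁ b₂ incl ∷ conforms-transfer S inL bS conf

-- A family of matrix pairs containing the seeds and closed under the operations that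
-- interpret ∪E, ∘E and star contains the summary of every path expression, so the hypotheses
-- of `Indistinguishable` need only be checked on the family.
module Certificate {n₁ n₂} (A₁ : Matrix n₁) (A₂ : Matrix n₂) where

  Summary : Set
  Summary = Matrix n₁ × Matrix n₂ × Bool

  sameₛ : Summary → Summary → Bool
  sameₛ (M₁ , M₂ , ν) (N₁ , N₂ , μ) = ν ==ᵇ μ ∧ sameMatrix M₁ N₁ ∧ sameMatrix M₂ N₂

  sameₛ-sound : ∀ x y → T (sameₛ x y) → x ≡ y
  sameₛ-sound (M₁ , M₂ , ν) (N₁ , N₂ , μ) t with Equivalence.to (T-∧ {ν ==ᵇ μ}) t
  ... | t₀ , t₁₂ with Equivalence.to (T-∧ {sameMatrix M₁ N₁}) t₁₂
  ...   | t₁ , t₂ with ==ᵇ-sound ν μ t₀ | sameMatrix-sound M₁ N₁ t₁ | sameMatrix-sound M₂ N₂ t₂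
  ...     | refl | refl | refl = refl

  infix 4 _∈ₛ_
  _∈ₛ_ : Summary → List Summary → Bool
  x ∈ₛ R = any (sameₛ x) R

  ∈ₛ-sound : ∀ {x} R → T (x ∈ₛ R) → x ∈ R
  ∈ₛ-sound {x} R t = Any.map (sameₛ-sound x _) (any⁻ (sameₛ x) R t)

  _∪ₛ_ _∘ₛ_ : Summary → Summary → Summary
  (M₁ , M₂ , ν) ∪ₛ (N₁ , N₂ , μ) = M₁ ⊕ N₁ , M₂ ⊕ N₂ , ν ∨ μ
  (M₁ , M₂ , ν) ∘ₛ (N₁ , N₂ , μ) = compose M₁ ν N₁ μ , compose M₂ ν N₂ μ , ν ∧ μ

  _⁺ₛ : Summary → Summary
  (M₁ , M₂ , _) ⁺ₛ = plus M₁ , plus M₂ , true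

  seeds : List Summary
  seeds = (O , O , true) ∷ (O , O , false) ∷ (O ᵀ , O ᵀ , false) ∷
          (A₁ , A₂ , false) ∷ (A₁ ᵀ , A₂ ᵀ , false) ∷ []

  Closed : List Summary → Set
  Closed R = All (_∈ R) seeds × All (λ x → x ⁺ₛ ∈ R × All (λ y → x ∪ₛ y ∈ R × x ∘ₛ y ∈ R) R) R

  closedᵇ : List Summary → Bool
  closedᵇ R =
    all (_∈ₛ R) seeds ∧ all (λ x → (x ⁺ₛ ∈ₛ R) ∧ all (λ y → (x ∪ₛ y ∈ₛ R) ∧ (x ∘ₛ y ∈ₛ R)) R) R

  closedᵇ-sound : ∀ R → T (closedᵇ R) → Closed R
  closedᵇ-sound R t with Equivalence.to (T-∧ {all (_∈ₛ R) seeds}) t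
  ... | t₀ , t₁ = All.map (∈ₛ-sound R) (all⁺ _ seeds t₀) , All.map closed-at (all⁺ _ R t₁)
    where
      closed-at : ∀ {x} → T ((x ⁺ₛ ∈ₛ R) ∧ all (λ y → (x ∪ₛ y ∈ₛ R) ∧ (x ∘ₛ y ∈ₛ R)) R) →
                  x ⁺ₛ ∈ R × All (λ y → x ∪ₛ y ∈ R × x ∘ₛ y ∈ R) R
      closed-at {x} t with Equivalence.to (T-∧ {x ⁺ₛ ∈ₛ R}) t
      ... | t⁺ , t′ = ∈ₛ-sound R t⁺ , All.map closed-with (all⁺ _ R t′)
        where
          closed-with : ∀ {y} → T ((x ∪ₛ y ∈ₛ R) ∧ (x ∘ₛ y ∈ₛ R)) → x ∪ₛ y ∈ R × x ∘ₛ y ∈ R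
          closed-with {y} u =
            let (t∪ , t∘) = Equivalence.to (T-∧ {x ∪ₛ y ∈ₛ R}) u in ∈ₛ-sound R t∪ , ∈ₛ-sound R t∘

  RowsAgree : (Fin n₁ → Bool) → (Fin n₂ → Bool) → Set
  RowsAgree f g = ∀ u v → f u ≡ g v

  rowsAgree? : ∀ f g → Dec (RowsAgree f g)
  rowsAgree? f g = all? λ u → all? λ v → f u ≟ᵇ g v

  Coherent : Summary → Set
  Coherent (M₁ , M₂ , _) =
    PlusComplete M₁ × PlusComplete M₂ × RowsAgree (⌊_⌋ ∘ edgesFrom? M₁) (⌊_⌋ ∘ edgesFrom? M₂)

  coherent? : ∀ x → Dec (Coherent x)
  coherent? (M₁ , M₂ , _) = plusComplete? M₁ ×-dec plusComplete? M₂ ×-dec rowsAgree? _ _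

  SameRowsAgree DisjointRowsAgree : Summary → Set
  SameRowsAgree (M₁ , M₂ , ν) =
    RowsAgree (λ u → ⌊ sameRow? M₁ ν A₁ u ⌋) (λ v → ⌊ sameRow? M₂ ν A₂ v ⌋) ×
    RowsAgree (λ u → ⌊ sameRow? M₁ ν O u ⌋) (λ v → ⌊ sameRow? M₂ ν O v ⌋)
  DisjointRowsAgree (M₁ , M₂ , ν) =
    RowsAgree (λ u → ⌊ disjointRow? M₁ ν A₁ u ⌋) (λ v → ⌊ disjointRow? M₂ ν A₂ v ⌋) ×
    RowsAgree (λ u → ⌊ disjointRow? M₁ ν O u ⌋) (λ v → ⌊ disjointRow? M₂ ν O v ⌋)

  sameRowsAgree? : ∀ x → Dec (SameRowsAgree x)
  sameRowsAgree? _ = rowsAgree? _ _ ×-dec rowsAgree? _ _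

  disjointRowsAgree? : ∀ x → Dec (DisjointRowsAgree x)
  disjointRowsAgree? _ = rowsAgree? _ _ ×-dec rowsAgree? _ _

  module _ (K m r : ℕ) where
    module B₁ = BlowUp K m r A₁
    module B₂ = BlowUp K m r A₂

    summary : PathExpr → Summary
    summary E = B₁.τ E , B₂.τ E , nullable E

    summary∈ : ∀ {R} → Closed R → ∀ E → summary E ∈ R
    summary∈ (seeds∈ , _) idE = All.lookup seeds∈ (here refl)
    summary∈ (seeds∈ , _) (prop p) with p ≟ r
    ... | yes _ = All.lookup seeds∈ (there (there (there (here refl))))
    ... | no _ = All.lookup seeds∈ (there (here refl))
    summary∈ (seeds∈ , _) (inv p) with p ≟ r
    ... | yes _ = All.lookup seeds∈ (there (there (there (there (here refl)))))
    ... | no _ = All.lookup seeds∈ (there (there (here refl)))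
    summary∈ cl@(_ , closure) (E₁ ∪E E₂) =
      proj₁ (All.lookup (proj₂ (All.lookup closure (summary∈ cl E₁))) (summary∈ cl E₂))
    summary∈ cl@(_ , closure) (E₁ ∘E E₂) =
      proj₂ (All.lookup (proj₂ (All.lookup closure (summary∈ cl E₁))) (summary∈ cl E₂))
    summary∈ cl@(_ , closure) (star E) = proj₁ (All.lookup closure (summary∈ cl E))

    indistinguishable : ∀ F {R} → Closed R → All Coherent R →
                        (F eq ≡ true → All SameRowsAgree R) → (F disj ≡ true → All DisjointRowsAgree R) →
                        Transfer.Indistinguishable K m r A₁ A₂ F
    indistinguishable F closure coherent sameRows disjointRows = record
      { complete₁ = proj₁ ∘ holds coherent
      ; complete₂ = proj₁ ∘ proj₂ ∘ holds coherent
      ; edgesFrom-agree = proj₂ ∘ proj₂ ∘ holds coherent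
      ; sameRow-agree = λ F∋eq E p →
          by-edgeMatrix {f = λ P u → ⌊ sameRow? (B₁.τ E) (nullable E) P u ⌋}
                        {g = λ P v → ⌊ sameRow? (B₂.τ E) (nullable E) P v ⌋} p (holds (sameRows F∋eq) E)
      ; disjointRow-agree = λ F∋disj E p →
          by-edgeMatrix {f = λ P u → ⌊ disjointRow? (B₁.τ E) (nullable E) P u ⌋}
                        {g = λ P v → ⌊ disjointRow? (B₂.τ E) (nullable E) P v ⌋} p (holds (disjointRows F∋disj) E)
      }
      where
        holds : ∀ {P : Summary → Set} → All P _ → ∀ E → P (summary E)
        holds all E = All.lookup all (summary∈ closure E)
        by-edgeMatrix : ∀ {f : Matrix n₁ → Fin n₁ → Bool} {g : Matrix n₂ → Fin n₂ → Bool} p →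
                        RowsAgree (f A₁) (g A₂) × RowsAgree (f O) (g O) →
                        RowsAgree (f (B₁.edgeMatrix p)) (g (B₂.edgeMatrix p))
        by-edgeMatrix p with p ≟ r
        ... | yes _ = proj₁
        ... | no _ = proj₂

undefinable : ∀ {F C} →
              (∀ S → InL F S → ∃ λ G₁ → ∃ λ G₂ → C G₁ × ¬ C G₂ × (Conforms G₁ S → Conforms G₂ S)) →
              ¬ DefinableIn F C
undefinable separate (S , inL , defines) with separate S inL
... | G₁ , G₂ , c₁ , ¬c₂ , transfer =
  ¬c₂ (Equivalence.to (defines G₂) (transfer (Equivalence.from (defines G₁) c₁)))

module _ {n₁ n₂} (A₁ : Matrix n₁) (A₂ : Matrix n₂) (r : Prop) (F : FeatureSet) (C : Graph → Set) where
  open BlowUp using (G)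

  blowUp-undefinable : n₁ ≤ n₂ → Fin n₁ → (∀ K → Transfer.Indistinguishable K K r A₁ A₂ F) →
                       (∀ K → C (G K K r A₁)) → (∀ K → Fin K → ¬ C (G K K r A₂)) → ¬ DefinableIn F C
  blowUp-undefinable n₁≤n₂ u₀ indistinguishable inside outside = undefinable λ S inL →
    let N , bS = bounded-schema S inL
        K = 2 + N
    in G K K r A₁ , G K K r A₂ , inside K , outside K zero ,
       Transfer.conforms-transfer K K r A₁ A₂ F (indistinguishable K) n₁≤n₂ u₀ (s≤s (s≤s z≤n)) ≤-refl S inL
         (bS (m≤n+m N 2))

-- The eq case: one complete block against two blocks 0 → 1 with no way back.

full : Matrix n
full = matrix λ _ _ → true

chain : Matrix 2
chain = matrix λ u v → toℕ u ≤ᵇ toℕ v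

module EqCertificate = Certificate (full {1}) chain

eq-summaries : List EqCertificate.Summary
eq-summaries =
  (O , O , true) ∷ (O , O , false) ∷
  (full , chain , false) ∷ (full , chain ᵀ , false) ∷ (full , chain , true) ∷ (full , chain ᵀ , true) ∷
  (full , full , false) ∷ (full , full , true) ∷ []

-- The disj case: block u has edges to u + s (mod n) for s ∈ S. With offsets 1 and 2 each block
-- of ℤ/4 has the mutual neighbour u + 2, whereas no block of ℤ/5 has a mutual neighbour.

circulant : ∀ n → .{{NonZero n}} → List ℕ → Matrix n
circulant n S = matrix λ u v → ⌊ ((toℕ v + n ∸ toℕ u) % n) ∈? S ⌋

ℤ₄ ℤ₅ : Matrix _
ℤ₄ = circulant 4 (1 ∷ 2 ∷ [])
ℤ₅ = circulant 5 (1 ∷ 2 ∷ [])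

module DisjCertificate = Certificate ℤ₄ ℤ₅

disj-summaries : List DisjCertificate.Summary
disj-summaries =
  (circulant 4 (0 ∷ 1 ∷ 2 ∷ 3 ∷ []) , circulant 5 (0 ∷ 1 ∷ 2 ∷ 3 ∷ 4 ∷ []) , false) ∷
  (circulant 4 (0 ∷ 1 ∷ 2 ∷ 3 ∷ []) , circulant 5 (0 ∷ 1 ∷ 2 ∷ 3 ∷ 4 ∷ []) , true) ∷
  (circulant 4 (0 ∷ 1 ∷ 2 ∷ 3 ∷ []) , circulant 5 (1 ∷ 2 ∷ 3 ∷ 4 ∷ []) , true) ∷
  (circulant 4 [] , circulant 5 [] , false) ∷
  (circulant 4 (1 ∷ 2 ∷ 3 ∷ []) , circulant 5 (1 ∷ 2 ∷ 3 ∷ 4 ∷ []) , true) ∷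
  (circulant 4 (0 ∷ 1 ∷ 2 ∷ 3 ∷ []) , circulant 5 (1 ∷ 2 ∷ 3 ∷ 4 ∷ []) , false) ∷
  (circulant 4 (0 ∷ 1 ∷ 2 ∷ 3 ∷ []) , circulant 5 (0 ∷ 1 ∷ 2 ∷ 4 ∷ []) , true) ∷
  (circulant 4 (0 ∷ 1 ∷ 2 ∷ 3 ∷ []) , circulant 5 (0 ∷ 1 ∷ 3 ∷ 4 ∷ []) , true) ∷
  (circulant 4 (0 ∷ 1 ∷ 2 ∷ 3 ∷ []) , circulant 5 (0 ∷ 1 ∷ 2 ∷ 3 ∷ []) , true) ∷
  (circulant 4 (0 ∷ 1 ∷ 2 ∷ 3 ∷ []) , circulant 5 (0 ∷ 2 ∷ 3 ∷ 4 ∷ []) , true) ∷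
  (circulant 4 (0 ∷ 2 ∷ 3 ∷ []) , circulant 5 (2 ∷ 3 ∷ 4 ∷ []) , true) ∷
  (circulant 4 (0 ∷ 1 ∷ 2 ∷ []) , circulant 5 (1 ∷ 2 ∷ 3 ∷ []) , true) ∷
  (circulant 4 (0 ∷ 1 ∷ 2 ∷ 3 ∷ []) , circulant 5 (0 ∷ 1 ∷ 2 ∷ 4 ∷ []) , false) ∷
  (circulant 4 (0 ∷ 1 ∷ 2 ∷ 3 ∷ []) , circulant 5 (0 ∷ 1 ∷ 3 ∷ 4 ∷ []) , false) ∷
  (circulant 4 (0 ∷ 1 ∷ 2 ∷ 3 ∷ []) , circulant 5 (0 ∷ 1 ∷ 2 ∷ 3 ∷ []) , false) ∷
  (circulant 4 (0 ∷ 1 ∷ 2 ∷ 3 ∷ []) , circulant 5 (0 ∷ 2 ∷ 3 ∷ 4 ∷ []) , false) ∷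
  (circulant 4 (1 ∷ 2 ∷ []) , circulant 5 (1 ∷ 2 ∷ []) , true) ∷
  (circulant 4 (2 ∷ 3 ∷ []) , circulant 5 (3 ∷ 4 ∷ []) , true) ∷
  (circulant 4 (1 ∷ 2 ∷ 3 ∷ []) , circulant 5 (1 ∷ 2 ∷ 3 ∷ 4 ∷ []) , false) ∷
  (circulant 4 (0 ∷ 1 ∷ 3 ∷ []) , circulant 5 (0 ∷ 1 ∷ 4 ∷ []) , true) ∷
  (circulant 4 (0 ∷ 2 ∷ 3 ∷ []) , circulant 5 (2 ∷ 3 ∷ 4 ∷ []) , false) ∷
  (circulant 4 (0 ∷ 1 ∷ 2 ∷ []) , circulant 5 (1 ∷ 2 ∷ 3 ∷ []) , false) ∷
  (circulant 4 (0 ∷ 1 ∷ 3 ∷ []) , circulant 5 (0 ∷ 1 ∷ 4 ∷ []) , false) ∷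
  (circulant 4 [] , circulant 5 [] , true) ∷
  (circulant 4 (1 ∷ 2 ∷ []) , circulant 5 (1 ∷ 2 ∷ []) , false) ∷
  (circulant 4 (2 ∷ 3 ∷ []) , circulant 5 (3 ∷ 4 ∷ []) , false) ∷
  []

opaque
  unfolding O _⊕_ _⊗_ _ᵀ

  eq-closed : EqCertificate.Closed eq-summaries
  eq-closed = EqCertificate.closedᵇ-sound _ _

  eq-coherent : All EqCertificate.Coherent eq-summaries
  eq-coherent = toWitness {a? = All.all? EqCertificate.coherent? eq-summaries} _

  eq-disjointRows : All EqCertificate.DisjointRowsAgree eq-summaries
  eq-disjointRows = toWitness {a? = All.all? EqCertificate.disjointRowsAgree? eq-summaries} _

  disj-closed : DisjCertificate.Closed disj-summaries
  disj-closed = DisjCertificate.closedᵇ-sound _ _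

  disj-coherent : All DisjCertificate.Coherent disj-summaries
  disj-coherent = toWitness {a? = All.all? DisjCertificate.coherent? disj-summaries} _

  disj-sameRows : All DisjCertificate.SameRowsAgree disj-summaries
  disj-sameRows = toWitness {a? = All.all? DisjCertificate.sameRowsAgree? disj-summaries} _

ℤ₄-mutual : ∀ {u v} → Adj ℤ₄ u v → ∃ λ w → Adj ℤ₄ u w × Adj ℤ₄ w u
ℤ₄-mutual {u} {v} =
  toWitness {a? = all? λ u → all? λ v → adj? ℤ₄ u v →-dec any? λ w → adj? ℤ₄ u w ×-dec adj? ℤ₄ w u} _ u v

ℤ₅-lonely : ∀ w → Adj ℤ₅ zero w → ¬ Adj ℤ₅ w zero
ℤ₅-lonely = toWitness {a? = all? λ w → adj? ℤ₅ zero w →-dec ¬? (adj? ℤ₅ w zero)} _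

true≢false : true ≢ false
true≢false ()

eq-undefinable : ∀ r F → F eq ≡ false → ¬ DefinableIn F (Q eq r)
eq-undefinable r F F∌eq = blowUp-undefinable full chain r F (Q eq r) (s≤s z≤n) zero
  (λ K → EqCertificate.indistinguishable K K r F eq-closed eq-coherent
           (λ F∋eq → ⊥-elim (true≢false (trans (sym F∋eq) F∌eq))) (λ _ → eq-disjointRows))
  (λ K → BlowUp.symmetric⇒Q-eq K K r full λ { {zero} {zero} x → x })
  (λ K i → BlowUp.asymmetric⇒¬Q-eq K K r chain {zero} {suc zero} i (adj _) λ { (adj ()) })

disj-undefinable : ∀ r F → F disj ≡ false → ¬ DefinableIn F (Q disj r)
disj-undefinable r F F∌disj = blowUp-undefinable ℤ₄ ℤ₅ r F (Q disj r) (s≤s (s≤s (s≤s (s≤s z≤n)))) zero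
  (λ K → DisjCertificate.indistinguishable K K r F disj-closed disj-coherent
           (λ _ → disj-sameRows) (λ F∋disj → ⊥-elim (true≢false (trans (sym F∋disj) F∌disj))))
  (λ K → BlowUp.mutual⇒Q-disj K K r ℤ₄ ℤ₄-mutual)
  (λ K i → BlowUp.lonely⇒¬Q-disj K K r ℤ₅ {zero} {suc zero} i (adj _) ℤ₅-lonely)

-- The closed case

pathProps : PathExpr → ℕ
pathProps idE = 0
pathProps (prop p) = p
pathProps (inv p) = p
pathProps (E₁ ∪E E₂) = pathProps E₁ ⊔ pathProps E₂
pathProps (E₁ ∘E E₂) = pathProps E₁ ⊔ pathProps E₂
pathProps (star E) = pathProps E

shapeProps : Shape → ℕ
shapeProps ⊤S = 0
shapeProps (const c) = 0
shapeProps (φ ∧S ψ) = shapeProps φ ⊔ shapeProps ψ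
shapeProps (φ ∨S ψ) = shapeProps φ ⊔ shapeProps ψ
shapeProps (¬S φ) = shapeProps φ
shapeProps (≥[ k ] E ∙ ψ) = pathProps E ⊔ shapeProps ψ
shapeProps (eqS E p) = pathProps E ⊔ p
shapeProps (disjS E p) = pathProps E ⊔ p
shapeProps (closedS R) = 0

schemaProps : Schema → ℕ
schemaProps [] = 0
schemaProps ((φ₁ , φ₂) ∷ S) = shapeProps φ₁ ⊔ shapeProps φ₂ ⊔ schemaProps S

module Extension {G G′ : Graph} (q : ℕ) (G⊆G′ : ∀ {t} → t ∈ G → t ∈ G′)
                 (below-q : ∀ {a p b} → p < q → (a , p , b) ∈ G′ → (a , p , b) ∈ G) where

  ⟦⟧-mono : ∀ E {a b} → ⟦ E ⟧E G a b → ⟦ E ⟧E G′ a b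
  ⟦⟧-mono idE e = e
  ⟦⟧-mono (prop p) e = G⊆G′ e
  ⟦⟧-mono (inv p) e = G⊆G′ e
  ⟦⟧-mono (E₁ ∪E E₂) = Sum.map (⟦⟧-mono E₁) (⟦⟧-mono E₂)
  ⟦⟧-mono (E₁ ∘E E₂) (c , e₁ , e₂) = c , ⟦⟧-mono E₁ e₁ , ⟦⟧-mono E₂ e₂
  ⟦⟧-mono (star E) = Star.map (⟦⟧-mono E)

  ⟦⟧-below : ∀ E → pathProps E < q → ∀ {a b} → ⟦ E ⟧E G′ a b → ⟦ E ⟧E G a b
  ⟦⟧-below idE _ e = e
  ⟦⟧-below (prop p) p<q e = below-q p<q e
  ⟦⟧-below (inv p) p<q e = below-q p<q e
  ⟦⟧-below (E₁ ∪E E₂) <q = Sum.map (⟦⟧-below E₁ (m⊔n<o⇒m<o _ _ <q)) (⟦⟧-below E₂ (m⊔n<o⇒n<o _ _ <q))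
  ⟦⟧-below (E₁ ∘E E₂) <q (c , e₁ , e₂) =
    c , ⟦⟧-below E₁ (m⊔n<o⇒m<o _ _ <q) e₁ , ⟦⟧-below E₂ (m⊔n<o⇒n<o _ _ <q) e₂
  ⟦⟧-below (star E) <q = Star.map (⟦⟧-below E <q)

  ⟦⟧-extension : ∀ E → pathProps E < q → ∀ {a b} → ⟦ E ⟧E G a b ⇔ ⟦ E ⟧E G′ a b
  ⟦⟧-extension E <q = mk⇔ (⟦⟧-mono E) (⟦⟧-below E <q)

  module _ {F : FeatureSet} (F∌closed : F closed ≡ false) where

    ⊨-extension : ∀ ψ → ShapeIn F ψ → shapeProps ψ < q → ∀ {z} → G , z ⊨ ψ ⇔ G′ , z ⊨ ψ
    ⊨-extension ⊤S _ _ = ⇔-refl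
    ⊨-extension (const c) _ _ = ⇔-refl
    ⊨-extension (φ ∧S ψ) (iφ , iψ) <q =
      ⊨-extension φ iφ (m⊔n<o⇒m<o _ _ <q) ×-⇔ ⊨-extension ψ iψ (m⊔n<o⇒n<o _ _ <q)
    ⊨-extension (φ ∨S ψ) (iφ , iψ) <q =
      ⊨-extension φ iφ (m⊔n<o⇒m<o _ _ <q) ⊎-⇔ ⊨-extension ψ iψ (m⊔n<o⇒n<o _ _ <q)
    ⊨-extension (¬S φ) iφ <q = mk⇔ (λ ¬s → ¬s ∘ Equivalence.from φ⇔) (λ ¬s → ¬s ∘ Equivalence.to φ⇔)
      where
        φ⇔ : ∀ {z} → G , z ⊨ φ ⇔ G′ , z ⊨ φ
        φ⇔ = ⊨-extension φ iφ <q
    ⊨-extension (≥[ k ] E ∙ ψ) (_ , iψ) <q = mk⇔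
      (λ (bs , len , unique , goods) →
        bs , len , unique , All.map (Product.map (Equivalence.to E⇔) (Equivalence.to ψ⇔)) goods)
      (λ (bs , len , unique , goods) →
        bs , len , unique , All.map (Product.map (Equivalence.from E⇔) (Equivalence.from ψ⇔)) goods)
      where
        E⇔ : ∀ {a b} → ⟦ E ⟧E G a b ⇔ ⟦ E ⟧E G′ a b
        E⇔ = ⟦⟧-extension E (m⊔n<o⇒m<o _ _ <q)
        ψ⇔ : ∀ {z} → G , z ⊨ ψ ⇔ G′ , z ⊨ ψ
        ψ⇔ = ⊨-extension ψ iψ (m⊔n<o⇒n<o _ _ <q)
    ⊨-extension (eqS E p) _ <q =
      mk⇔ (λ s b → ⇔-trans (⇔-sym E⇔) (⇔-trans (s b) p⇔)) (λ s b → ⇔-trans E⇔ (⇔-trans (s b) (⇔-sym p⇔)))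
      where
        E⇔ : ∀ {a b} → ⟦ E ⟧E G a b ⇔ ⟦ E ⟧E G′ a b
        E⇔ = ⟦⟧-extension E (m⊔n<o⇒m<o _ _ <q)
        p⇔ : ∀ {a b} → (a , p , b) ∈ G ⇔ (a , p , b) ∈ G′
        p⇔ = ⟦⟧-extension (prop p) (m⊔n<o⇒n<o _ _ <q)
    ⊨-extension (disjS E p) _ <q = mk⇔
      (λ s b e e′ → s b (Equivalence.from E⇔ e) (Equivalence.from p⇔ e′))
      (λ s b e e′ → s b (Equivalence.to E⇔ e) (Equivalence.to p⇔ e′))
      where
        E⇔ : ∀ {a b} → ⟦ E ⟧E G a b ⇔ ⟦ E ⟧E G′ a b
        E⇔ = ⟦⟧-extension E (m⊔n<o⇒m<o _ _ <q)
        p⇔ : ∀ {a b} → (a , p , b) ∈ G ⇔ (a , p , b) ∈ G′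
        p⇔ = ⟦⟧-extension (prop p) (m⊔n<o⇒n<o _ _ <q)
    ⊨-extension (closedS R) F∋closed _ = ⊥-elim (true≢false (trans (sym F∋closed) F∌closed))

    conforms-extension : ∀ S → InL F S → schemaProps S < q → Conforms G S → Conforms G′ S
    conforms-extension [] [] _ [] = []
    conforms-extension ((φ₁ , φ₂) ∷ S) ((i₁ , i₂) ∷ inL) <q (incl ∷ conf) =
      (λ z s → Equivalence.to φ₂⇔ (incl z (Equivalence.from φ₁⇔ s))) ∷ conforms-extension S inL (m⊔n<o⇒n<o _ _ <q) conf
      where
        <φ : shapeProps φ₁ ⊔ shapeProps φ₂ < q
        <φ = m⊔n<o⇒m<o _ _ <q
        φ₁⇔ : ∀ {z} → G , z ⊨ φ₁ ⇔ G′ , z ⊨ φ₁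
        φ₁⇔ = ⊨-extension φ₁ i₁ (m⊔n<o⇒m<o _ _ <φ)
        φ₂⇔ : ∀ {z} → G , z ⊨ φ₂ ⇔ G′ , z ⊨ φ₂
        φ₂⇔ = ⊨-extension φ₂ i₂ (m⊔n<o⇒n<o _ _ <φ)

closed-undefinable : ∀ r F → F closed ≡ false → ¬ DefinableIn F (Q closed r)
closed-undefinable r F F∌closed = undefinable λ S inL →
  let q = suc (schemaProps S ⊔ r)
      G⊆G′ : ∀ {t} → t ∈ (0 , r , 0) ∷ [] → t ∈ (0 , r , 0) ∷ (0 , q , 0) ∷ []
      G⊆G′ = λ { (here e) → here e }
      below-q : ∀ {a p b} → p < q →
                (a , p , b) ∈ (0 , r , 0) ∷ (0 , q , 0) ∷ [] → (a , p , b) ∈ (0 , r , 0) ∷ []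
      below-q = λ { _ (here e) → here e ; p<q (there (here refl)) → ⊥-elim (<-irrefl refl p<q) }
  in (0 , r , 0) ∷ [] , (0 , r , 0) ∷ (0 , q , 0) ∷ [] ,
     (λ { _ _ _ _ _ (here refl) → refl }) ,
     (λ only-r → <-irrefl (sym (only-r 0 0 q 0 (here refl) (there (here refl)))) (s≤s (m≤n⊔m (schemaProps S) r))) ,
     Extension.conforms-extension q G⊆G′ below-q F∌closed S inL (s≤s (m≤m⊔n (schemaProps S) r))

theorem3p1 : (r : Prop) (X : Feature) (F : FeatureSet) → F X ≡ false → ¬ DefinableIn F (Q X r)
theorem3p1 r eq = eq-undefinable r
theorem3p1 r disj = disj-undefinable r
theorem3p1 r closed = closed-undefinable r
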